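{- Let $G$ and $G'$ be two graphs on the same set $V$ of $v$ vertices (possibly infinite). Let $k$ be an integer with $3\leq k\leq v-2$ and $k\equiv 3 \pmod 4$. Then the following are equivalent: (i) for all $k$-element subsets $K$ of $V$, $e(G_{\restriction K})$ has the same parity as $e(G'_{\restriction K})$, and $G_{\restriction K}$, $G'_{\restriction K}$ have the same $3$-homogeneous subsets; (ii) $G'=G$.
   Context: Graphs are simple undirected graphs; $G_{\restriction K}$ is the induced subgraph on $K$ and $e(H)$ is the number of edges of $H$. A $3$-element vertex subset is a $3$-homogeneous subset of a graph $H$ if it induces a triangle in $H$ or in its complement (all three pairs are edges, or none). -}

module Defs where

open import Data.Bool using (Bool; true; false)
open import Data.Nat using (ℕ; zero; suc; _+_)
open import Data.List using (List; []; _∷_; length)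
open import Data.List.Relation.Unary.Unique.Propositional using (Unique)
open import Data.List.Membership.Propositional using (_∈_)
open import Data.Product using (_×_)
open import Relation.Binary.PropositionalEquality using (_≡_; _≢_)

record Graph (V : Set) : Set where
  field
    adj   : V → V → Bool
    sym   : ∀ x y → adj x y ≡ adj y x
    irrfl : ∀ x → adj x x ≡ false
open Graph public

record Subset (V : Set) (k : ℕ) : Set where
  field
    elems  : List V
    unique : Unique elems
    size   : length elems ≡ k
open Subset public

degIn : ∀ {V : Set} → Graph V → V → List V → ℕ
degIn G x []       = 0
degIn G x (y ∷ ys) with adj G x y
... | true  = suc (degIn G x ys)
... | false = degIn G x ys

edgesOn : ∀ {V : Set} → Graph V → List V → ℕ
edgesOn G []       = 0
edgesOn G (x ∷ xs) = degIn G x xs + edgesOn G xs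

Homog3 : ∀ {V : Set} → Graph V → V → V → V → Set
Homog3 G x y z = (adj G x y ≡ adj G y z) × (adj G y z ≡ adj G x z)

module Submission where

-- Let D be the graph of pairs on which G and G' disagree.  For distinct
-- vertices x, y, choose a set W of k + 2 vertices containing both.  Every
-- k-subset of W is W with two vertices i, j deleted, and deleting them gives,
-- in any graph,
--     D(i,j) = E ⊕ Δ(i) ⊕ Δ(j) ⊕ [e_D(W - i - j) is odd],
-- where E and Δ(v) are the parities of e_D(W) and of the D-degree of v in W.
-- Condition (i) makes e_D even on k-sets, so D is affine on W; summing over
-- all pairs of W with |W| ≡ 1 (mod 4) gives E = 0, i.e. D is the complete
-- bipartite graph between the classes {Δ = 0} and {Δ = 1}.  Equal
-- 3-homogeneous triples forbid three vertices of one class together with one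
-- of the other (their three G-edges to the lonely vertex would be pairwise
-- different Booleans), so among five vertices of W any two share a class;
-- in particular D(x,y) = 0.  The converse direction is immediate.

open import Defs hiding (sym)
open import Data.Bool using (Bool; true; false; not; _xor_; _∧_)
open import Data.Bool.Properties
  using (xor-∧-commutativeRing; xor-same; xor-comm; xor-assoc; xor-identityʳ; xor-inverseˡ;
         not-involutive; not-distribˡ-xor; not-¬; ¬-not)
  renaming (_≟_ to _≟ᵇ_)
open import Data.Nat using (ℕ; zero; suc; _+_; _≤_; _%_; s≤s)
open import Data.Nat.Properties using (suc-injective; +-comm)
open import Data.Fin using (Fin; zero; suc; #_)
open import Data.Fin.Properties using () renaming (_≟_ to _≟ᶠ_)
open import Data.List using (List; []; _∷_; _++_; length; lookup)
open import Data.List.Properties using (length-removeAt′)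
open import Data.List.Membership.Propositional using (_∈_; _∉_)
open import Data.List.Membership.Propositional.Properties using (∈-lookup; ∈-++⁺ˡ)
open import Data.List.Relation.Unary.Any using (here; there; index; _─_)
open import Data.List.Relation.Unary.All as All using (_∷_)
open import Data.List.Relation.Unary.All.Properties using (─⁺; ¬Any⇒All¬)
  renaming (++⁻ˡ to All-++⁻ˡ; ++⁻ʳ to All-++⁻ʳ)
open import Data.List.Relation.Unary.Unique.Propositional using (Unique; []; _∷_)
open import Data.List.Relation.Unary.Unique.Propositional.Properties using (map⁺; ++⁺)
open import Data.List.Relation.Unary.Unique.DecPropositional (_≟ᶠ_ {5}) using (unique?)
open import Data.Maybe using (Maybe; just; nothing)
open import Data.Product using (_×_; Σ; _,_; proj₁; proj₂)
open import Data.Empty using (⊥; ⊥-elim)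
open import Function using (_∘_)
open import Function.Bundles using (_⇔_; mk⇔; Equivalence)
open import Level using (0ℓ)
open import Relation.Nullary using (¬_; Dec; yes; no)
open import Relation.Nullary.Decidable using (True; toWitness; decidable-stable; ¬¬-excluded-middle)
open import Relation.Nullary.Negation using (¬¬-map)
open import Relation.Binary.PropositionalEquality
  using (_≡_; _≢_; refl; sym; trans; cong; cong₂; module ≡-Reasoning)
open import Tactic.RingSolver using (solve-∀)
open import Tactic.RingSolver.Core.AlmostCommutativeRing
  using (AlmostCommutativeRing; fromCommutativeRing)

open ≡-Reasoning

boolRing : AlmostCommutativeRing 0ℓ 0ℓ
boolRing = fromCommutativeRing xor-∧-commutativeRing isFalse
  where
  isFalse : ∀ x → Maybe (false ≡ x)
  isFalse false = just refl
  isFalse true  = nothing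

xor-interchange : ∀ a b c d → (a xor b) xor (c xor d) ≡ (a xor c) xor (b xor d)
xor-interchange = solve-∀ boolRing

xor≡false⇒≡ : ∀ x y → x xor y ≡ false → x ≡ y
xor≡false⇒≡ false false _ = refl
xor≡false⇒≡ true  true  _ = refl

xor≡true⇒≡not : ∀ x y → x xor y ≡ true → y ≡ not x
xor≡true⇒≡not false true  _ = refl
xor≡true⇒≡not true  false _ = refl

≡⇒xor≡false : ∀ {x y} → x ≡ y → x xor y ≡ false
≡⇒xor≡false {y = y} refl = xor-same y

≢⇒xor≡true : ∀ {x y} → x ≢ y → x xor y ≡ true
≢⇒xor≡true {y = y} x≢y = trans (cong (_xor y) (¬-not x≢y)) (xor-inverseˡ y)

bool-two-valued : ∀ {x y z : Bool} → x ≢ y → y ≢ z → x ≡ z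
bool-two-valued x≢y y≢z = trans (¬-not x≢y) (sym (¬-not (y≢z ∘ sym)))

odd : ℕ → Bool
odd zero    = false
odd (suc n) = not (odd n)

odd-+ : ∀ m n → odd (m + n) ≡ odd m xor odd n
odd-+ zero    n = refl
odd-+ (suc m) n = trans (cong not (odd-+ m n)) (not-distribˡ-xor (odd m) (odd n))

odd-%2 : ∀ n → odd (n % 2) ≡ odd n
odd-%2 zero          = refl
odd-%2 (suc zero)    = refl
odd-%2 (suc (suc n)) = trans (odd-%2 n) (sym (not-involutive (odd n)))

choose2 : ℕ → ℕ
choose2 zero    = 0
choose2 (suc n) = n + choose2 n

odd-4+ : ∀ n → odd (4 + n) ≡ odd n
odd-4+ n = trans (not-involutive _) (not-involutive _)

odd-choose2-4+ : ∀ n → odd (choose2 (4 + n)) ≡ odd (choose2 n)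
odd-choose2-4+ n = begin
  odd (choose2 (4 + n))                                      ≡⟨ odd-+ (3 + n) _ ⟩
  odd (3 + n) xor odd (choose2 (3 + n))                      ≡⟨ cong (odd (3 + n) xor_) (odd-+ (2 + n) _) ⟩
  odd (3 + n) xor (odd (2 + n) xor odd (choose2 (2 + n)))    ≡⟨ cong (λ t → odd (3 + n) xor (odd (2 + n) xor t))
                                                                     (odd-+ (1 + n) _) ⟩
  odd (3 + n) xor (odd (2 + n) xor (odd (1 + n) xor odd (choose2 (1 + n))))
                                                             ≡⟨ cong (λ t → odd (3 + n) xor (odd (2 + n) xor (odd (1 + n) xor t)))
                                                                     (odd-+ n _) ⟩
  odd (3 + n) xor (odd (2 + n) xor (odd (1 + n) xor (odd n xor odd (choose2 n))))
                                                             ≡⟨ four-terms-cancel (odd n) (odd (choose2 n)) ⟩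
  odd (choose2 n)                                            ∎
  where
  four-terms-cancel : ∀ p c → (true xor (true xor (true xor p)))
                                xor ((true xor (true xor p)) xor ((true xor p) xor (p xor c))) ≡ c
  four-terms-cancel = solve-∀ boolRing

mod4-parities : ∀ k → k % 4 ≡ 3 → odd (2 + k) ≡ true × odd (choose2 (2 + k)) ≡ false
mod4-parities 0 ()
mod4-parities 1 ()
mod4-parities 2 ()
mod4-parities 3 _ = refl , refl
mod4-parities (suc (suc (suc (suc k)))) k%4≡3 =
  trans (odd-4+ (2 + k)) (proj₁ (mod4-parities k k%4≡3)) ,
  trans (odd-choose2-4+ (2 + k)) (proj₂ (mod4-parities k k%4≡3))

-- Deleting one entry of a list: L ─ p removes the entry that the membership
-- proof p points to, which needs no decidable equality on V.

module _ {V : Set} where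

  ─-length : ∀ {u : V} {L} (p : u ∈ L) → length L ≡ suc (length (L ─ p))
  ─-length {L = L} p = length-removeAt′ L (index p)

  ─-⊆ : ∀ {u w : V} {L} (p : u ∈ L) → w ∈ (L ─ p) → w ∈ L
  ─-⊆ (here _)  w∈         = there w∈
  ─-⊆ (there p) (here e)   = here e
  ─-⊆ (there p) (there w∈) = there (─-⊆ p w∈)

  ─-∈ : ∀ {u w : V} {L} → w ∈ L → (p : u ∈ L) → w ≢ u → w ∈ (L ─ p)
  ─-∈ (here w≡z)  (here u≡z) w≢u = ⊥-elim (w≢u (trans w≡z (sym u≡z)))
  ─-∈ (there w∈)  (here _)   _   = w∈
  ─-∈ (here w≡z)  (there _)  _   = here w≡z
  ─-∈ (there w∈)  (there p)  w≢u = there (─-∈ w∈ p w≢u)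

  ─-unique : ∀ {u : V} {L} (p : u ∈ L) → Unique L → Unique (L ─ p)
  ─-unique (here _)  (_ ∷ uniq)  = uniq
  ─-unique (there p) (z∉ ∷ uniq) = ─⁺ p z∉ ∷ ─-unique p uniq

  ─-∉ : ∀ {u : V} {L} → Unique L → (p : u ∈ L) → u ∉ (L ─ p)
  ─-∉ (u∉ ∷ _)    (here refl) u∈        = All.lookup u∉ u∈ refl
  ─-∉ (z∉ ∷ _)    (there p)   (here u≡z) = All.lookup z∉ p (sym u≡z)
  ─-∉ (_ ∷ uniq)  (there p)   (there u∈) = ─-∉ uniq p u∈

  ++-unique⁻ : ∀ xs {ys : List V} → Unique (xs ++ ys) →
               Unique xs × Unique ys × (∀ {v} → v ∈ xs → v ∉ ys)
  ++-unique⁻ []       uniq        = [] , uniq , λ ()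
  ++-unique⁻ (x ∷ xs) (x∉ ∷ uniq) with ++-unique⁻ xs uniq
  ... | xs-unique , ys-unique , disjoint =
    All-++⁻ˡ xs x∉ ∷ xs-unique , ys-unique , x-or-xs-∉
    where
    x-or-xs-∉ : ∀ {v} → v ∈ x ∷ xs → v ∉ _
    x-or-xs-∉ (here refl) v∈ys = All.lookup (All-++⁻ʳ xs x∉) v∈ys refl
    x-or-xs-∉ (there v∈xs)     = disjoint v∈xs

  lookup-injective : ∀ {xs : List V} → Unique xs → ∀ {i j} → lookup xs i ≡ lookup xs j → i ≡ j
  lookup-injective (_ ∷ _)    {zero}  {zero}  _  = refl
  lookup-injective (x∉ ∷ _)   {zero}  {suc j} eq = ⊥-elim (All.lookup x∉ (∈-lookup j) eq)
  lookup-injective (x∉ ∷ _)   {suc i} {zero}  eq = ⊥-elim (All.lookup x∉ (∈-lookup i) (sym eq))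
  lookup-injective (_ ∷ uniq) {suc i} {suc j} eq = cong suc (lookup-injective uniq eq)

module _ {V : Set} (Γ : Graph V) where

  deg-∷ : ∀ v u L → odd (degIn Γ v (u ∷ L)) ≡ adj Γ v u xor odd (degIn Γ v L)
  deg-∷ v u L with adj Γ v u
  ... | true  = refl
  ... | false = refl

  deg-─ : ∀ v {u L} (p : u ∈ L) → odd (degIn Γ v L) ≡ odd (degIn Γ v (L ─ p)) xor adj Γ v u
  deg-─ v {L = u ∷ L} (here refl) = trans (deg-∷ v u L) (xor-comm (adj Γ v u) (odd (degIn Γ v L)))
  deg-─ v {u} {w ∷ L} (there p) = begin
    odd (degIn Γ v (w ∷ L))                                ≡⟨ deg-∷ v w L ⟩
    adj Γ v w xor odd (degIn Γ v L)                        ≡⟨ cong (adj Γ v w xor_) (deg-─ v p) ⟩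
    adj Γ v w xor (odd (degIn Γ v (L ─ p)) xor adj Γ v u)  ≡⟨ xor-assoc (adj Γ v w) (odd (degIn Γ v (L ─ p))) (adj Γ v u) ⟨
    (adj Γ v w xor odd (degIn Γ v (L ─ p))) xor adj Γ v u  ≡⟨ cong (_xor adj Γ v u) (deg-∷ v w (L ─ p)) ⟨
    odd (degIn Γ v (w ∷ (L ─ p))) xor adj Γ v u            ∎

  edges-─ : ∀ {u L} (p : u ∈ L) → odd (edgesOn Γ L) ≡ odd (edgesOn Γ (L ─ p)) xor odd (degIn Γ u (L ─ p))
  edges-─ {L = u ∷ L} (here refl) =
    trans (odd-+ (degIn Γ u L) _) (xor-comm (odd (degIn Γ u L)) (odd (edgesOn Γ L)))
  edges-─ {u} {w ∷ L} (there p) = begin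
    odd (degIn Γ w L + edgesOn Γ L)
      ≡⟨ odd-+ (degIn Γ w L) _ ⟩
    odd (degIn Γ w L) xor odd (edgesOn Γ L)
      ≡⟨ cong₂ _xor_ (deg-─ w p) (edges-─ p) ⟩
    (odd (degIn Γ w L′) xor adj Γ w u) xor (odd (edgesOn Γ L′) xor odd (degIn Γ u L′))
      ≡⟨ xor-interchange (odd (degIn Γ w L′)) (adj Γ w u) (odd (edgesOn Γ L′)) (odd (degIn Γ u L′)) ⟩
    (odd (degIn Γ w L′) xor odd (edgesOn Γ L′)) xor (adj Γ w u xor odd (degIn Γ u L′))
      ≡⟨ cong₂ _xor_ (odd-+ (degIn Γ w L′) _) (trans (deg-∷ u w L′) (cong (_xor odd (degIn Γ u L′)) (Graph.sym Γ u w))) ⟨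
    odd (edgesOn Γ (w ∷ L′)) xor odd (degIn Γ u (w ∷ L′))
      ∎
    where L′ = L ─ p

  pair-deletion : ∀ {i j} L (p : i ∈ L) (q : j ∈ (L ─ p)) →
    adj Γ i j ≡ ((odd (edgesOn Γ L) xor odd (degIn Γ i L)) xor odd (degIn Γ j L))
                xor odd (edgesOn Γ (L ─ p ─ q))
  pair-deletion {i} {j} L p q = trans (Graph.sym Γ i j) (telescope E-eq Δi-eq Δj-eq)
    where
    E-eq : odd (edgesOn Γ L) ≡ (odd (edgesOn Γ (L ─ p ─ q)) xor odd (degIn Γ j (L ─ p ─ q)))
                               xor odd (degIn Γ i (L ─ p))
    E-eq = trans (edges-─ p) (cong (_xor _) (edges-─ q))
    Δi-eq : odd (degIn Γ i L) ≡ odd (degIn Γ i (L ─ p)) xor false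
    Δi-eq = trans (deg-─ i p) (cong (odd (degIn Γ i (L ─ p)) xor_) (irrfl Γ i))
    Δj-eq : odd (degIn Γ j L) ≡ (odd (degIn Γ j (L ─ p ─ q)) xor false) xor adj Γ j i
    Δj-eq = trans (deg-─ j p)
                  (cong (_xor adj Γ j i) (trans (deg-─ j q) (cong (odd (degIn Γ j (L ─ p ─ q)) xor_) (irrfl Γ j))))
    telescope : ∀ {E Δi Δj a b d s} → E ≡ (b xor a) xor d → Δi ≡ d xor false → Δj ≡ (a xor false) xor s →
                s ≡ ((E xor Δi) xor Δj) xor b
    telescope {a = a} {b} {d} {s} refl refl refl = cancel a b d s
      where
      cancel : ∀ a b d s → s ≡ ((((b xor a) xor d) xor (d xor false)) xor ((a xor false) xor s)) xor b
      cancel = solve-∀ boolRing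

module _ {V : Set} (G G' : Graph V) where

  difference : Graph V
  difference = record
    { adj   = λ u v → adj G u v xor adj G' u v
    ; sym   = λ u v → cong₂ _xor_ (Graph.sym G u v) (Graph.sym G' u v)
    ; irrfl = λ u → cong₂ _xor_ (irrfl G u) (irrfl G' u)
    }

  deg-difference : ∀ v L → odd (degIn difference v L) ≡ odd (degIn G v L) xor odd (degIn G' v L)
  deg-difference v []      = refl
  deg-difference v (u ∷ L) = begin
    odd (degIn difference v (u ∷ L))
      ≡⟨ deg-∷ difference v u L ⟩
    (adj G v u xor adj G' v u) xor odd (degIn difference v L)
      ≡⟨ cong ((adj G v u xor adj G' v u) xor_) (deg-difference v L) ⟩
    (adj G v u xor adj G' v u) xor (odd (degIn G v L) xor odd (degIn G' v L))
      ≡⟨ xor-interchange (adj G v u) (adj G' v u) (odd (degIn G v L)) (odd (degIn G' v L)) ⟩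
    (adj G v u xor odd (degIn G v L)) xor (adj G' v u xor odd (degIn G' v L))
      ≡⟨ cong₂ _xor_ (deg-∷ G v u L) (deg-∷ G' v u L) ⟨
    odd (degIn G v (u ∷ L)) xor odd (degIn G' v (u ∷ L))
      ∎

  edges-difference : ∀ L → odd (edgesOn difference L) ≡ odd (edgesOn G L) xor odd (edgesOn G' L)
  edges-difference []      = refl
  edges-difference (v ∷ L) = begin
    odd (degIn difference v L + edgesOn difference L)
      ≡⟨ odd-+ (degIn difference v L) _ ⟩
    odd (degIn difference v L) xor odd (edgesOn difference L)
      ≡⟨ cong₂ _xor_ (deg-difference v L) (edges-difference L) ⟩
    (odd (degIn G v L) xor odd (degIn G' v L)) xor (odd (edgesOn G L) xor odd (edgesOn G' L))
      ≡⟨ xor-interchange (odd (degIn G v L)) (odd (degIn G' v L)) (odd (edgesOn G L)) (odd (edgesOn G' L)) ⟩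
    (odd (degIn G v L) xor odd (edgesOn G L)) xor (odd (degIn G' v L) xor odd (edgesOn G' L))
      ≡⟨ cong₂ _xor_ (odd-+ (degIn G v L) _) (odd-+ (degIn G' v L) _) ⟨
    odd (edgesOn G (v ∷ L)) xor odd (edgesOn G' (v ∷ L))
      ∎

⨁ : {V : Set} → (V → Bool) → List V → Bool
⨁ f []      = false
⨁ f (v ∷ L) = f v xor ⨁ f L

module _ {V : Set} (Γ : Graph V) where

  affine-deg : ∀ (g : Bool) (f : V → Bool) a L → (∀ {b} → b ∈ L → adj Γ a b ≡ g xor f b) →
               odd (degIn Γ a L) ≡ (odd (length L) ∧ g) xor ⨁ f L
  affine-deg g f a []      _     = refl
  affine-deg g f a (b ∷ L) a~L = begin
    odd (degIn Γ a (b ∷ L))                            ≡⟨ deg-∷ Γ a b L ⟩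
    adj Γ a b xor odd (degIn Γ a L)                    ≡⟨ cong₂ _xor_ (a~L (here refl)) (affine-deg g f a L (a~L ∘ there)) ⟩
    (g xor f b) xor ((odd (length L) ∧ g) xor ⨁ f L)   ≡⟨ step g (f b) (odd (length L)) (⨁ f L) ⟩
    ((true xor odd (length L)) ∧ g) xor (f b xor ⨁ f L) ∎
    where
    step : ∀ g y p s → (g xor y) xor ((p ∧ g) xor s) ≡ ((true xor p) ∧ g) xor (y xor s)
    step = solve-∀ boolRing

  affine-edges : ∀ (c : Bool) (f : V → Bool) L → Unique L →
                 (∀ {a b} → a ∈ L → b ∈ L → a ≢ b → adj Γ a b ≡ (c xor f a) xor f b) →
                 odd (edgesOn Γ L) ≡ (odd (choose2 (length L)) ∧ c) xor (not (odd (length L)) ∧ ⨁ f L)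
  affine-edges c f []      _            _      = refl
  affine-edges c f (a ∷ L) (a∉L ∷ uniq) affine = begin
    odd (degIn Γ a L + edgesOn Γ L)
      ≡⟨ odd-+ (degIn Γ a L) _ ⟩
    odd (degIn Γ a L) xor odd (edgesOn Γ L)
      ≡⟨ cong₂ _xor_ (affine-deg (c xor f a) f a L (λ b∈L → affine (here refl) (there b∈L) (All.lookup a∉L b∈L)))
                     (affine-edges c f L uniq (λ a∈L b∈L → affine (there a∈L) (there b∈L))) ⟩
    ((n ∧ (c xor f a)) xor ⨁ f L) xor ((t ∧ c) xor ((true xor n) ∧ ⨁ f L))
      ≡⟨ step n t c (f a) (⨁ f L) ⟩
    ((n xor t) ∧ c) xor ((true xor (true xor n)) ∧ (f a xor ⨁ f L))
      ≡⟨ cong (λ o → (o ∧ c) xor (not (not n) ∧ (f a xor ⨁ f L))) (odd-+ (length L) _) ⟨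
    (odd (choose2 (suc (length L))) ∧ c) xor (not (odd (suc (length L))) ∧ ⨁ f (a ∷ L))
      ∎
    where
    n = odd (length L)
    t = odd (choose2 (length L))
    step : ∀ n t c y s → ((n ∧ (c xor y)) xor s) xor ((t ∧ c) xor ((true xor n) ∧ s))
                         ≡ ((n xor t) ∧ c) xor ((true xor (true xor n)) ∧ (y xor s))
    step = solve-∀ boolRing

-- Flipping exactly two edges ac, bc of a triangle changes its homogeneity
-- unless those two edges differ: with ac = bc = q and ab = p, exactly one of
-- "p = q" and "p = not q" holds.
two-flips-change-homogeneity : ∀ {p q r p' q' r'} → p ≡ p' → q' ≡ not q → r' ≡ not r → r ≡ q →
                               ¬ ((p ≡ q × q ≡ r) ⇔ (p' ≡ q' × q' ≡ r'))
two-flips-change-homogeneity {p} {q} refl refl refl refl same with p ≟ᵇ q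
... | yes p≡q = not-¬ p≡q (proj₁ (Equivalence.to same (p≡q , refl)))
... | no  p≢q = p≢q (proj₁ (Equivalence.from same (¬-not p≢q , refl)))

module FivePoints (δ : Fin 5 → Bool) (g : Fin 5 → Fin 5 → Bool)
  (separated : ∀ {a b c} → Unique (a ∷ b ∷ c ∷ []) → δ a ≡ δ b → δ c ≢ δ a → g a c ≢ g b c) where

  -- three points of one colour and one of the other would make the three
  -- Booleans g aᵢ c pairwise different
  not-three-against-one : ∀ a₁ a₂ a₃ c
    {d₁₂ : True (unique? (a₁ ∷ a₂ ∷ c ∷ []))} {d₂₃ : True (unique? (a₂ ∷ a₃ ∷ c ∷ []))}
    {d₁₃ : True (unique? (a₁ ∷ a₃ ∷ c ∷ []))} →
    δ a₁ ≡ δ a₂ → δ a₂ ≡ δ a₃ → δ c ≢ δ a₁ → ⊥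
  not-three-against-one a₁ a₂ a₃ c {d₁₂} {d₂₃} {d₁₃} δ₁≡δ₂ δ₂≡δ₃ δc≢δ₁ =
    separated (toWitness d₁₃) (trans δ₁≡δ₂ δ₂≡δ₃) δc≢δ₁
      (bool-two-valued (separated (toWitness d₁₂) δ₁≡δ₂ δc≢δ₁)
                       (separated (toWitness d₂₃) δ₂≡δ₃ (δc≢δ₁ ∘ (λ e → trans e (sym δ₁≡δ₂)))))

  same-colour : δ (# 0) ≡ δ (# 1)
  same-colour with δ (# 0) ≟ᵇ δ (# 1)
  ... | yes δ₀≡δ₁ = δ₀≡δ₁
  ... | no  δ₀≢δ₁ = majority (δ (# 2) ≟ᵇ δ (# 0)) (δ (# 3) ≟ᵇ δ (# 0)) (δ (# 4) ≟ᵇ δ (# 0))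
    where
    -- each of the points 2, 3, 4 has the colour of 0 or of 1, and
    -- two of them share one
    other : ∀ {i} → δ i ≢ δ (# 0) → δ i ≡ δ (# 1)
    other δi≢δ₀ = bool-two-valued δi≢δ₀ δ₀≢δ₁
    δ₁≢δ₀ : δ (# 1) ≢ δ (# 0)
    δ₁≢δ₀ = δ₀≢δ₁ ∘ sym
    majority : Dec (δ (# 2) ≡ δ (# 0)) → Dec (δ (# 3) ≡ δ (# 0)) → Dec (δ (# 4) ≡ δ (# 0)) → δ (# 0) ≡ δ (# 1)
    majority (yes e₂) (yes e₃) _        = ⊥-elim (not-three-against-one (# 0) (# 2) (# 3) (# 1) (sym e₂) (trans e₂ (sym e₃)) δ₁≢δ₀)
    majority (yes e₂) (no _)   (yes e₄) = ⊥-elim (not-three-against-one (# 0) (# 2) (# 4) (# 1) (sym e₂) (trans e₂ (sym e₄)) δ₁≢δ₀)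
    majority (no _)   (yes e₃) (yes e₄) = ⊥-elim (not-three-against-one (# 0) (# 3) (# 4) (# 1) (sym e₃) (trans e₃ (sym e₄)) δ₁≢δ₀)
    majority (no n₂)  (no n₃)  _        = ⊥-elim (not-three-against-one (# 1) (# 2) (# 3) (# 0) (sym (other n₂)) (trans (other n₂) (sym (other n₃))) δ₀≢δ₁)
    majority (no n₂)  (yes _)  (no n₄)  = ⊥-elim (not-three-against-one (# 1) (# 2) (# 4) (# 0) (sym (other n₂)) (trans (other n₂) (sym (other n₄))) δ₀≢δ₁)
    majority (yes _)  (no n₃)  (no n₄)  = ⊥-elim (not-three-against-one (# 1) (# 3) (# 4) (# 0) (sym (other n₃)) (trans (other n₃) (sym (other n₄))) δ₀≢δ₁)

Agree : {V : Set} → Graph V → Graph V → ℕ → Set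
Agree {V} G G' k = ∀ (K : Subset V k) →
  (edgesOn G (elems K) % 2 ≡ edgesOn G' (elems K) % 2)
  × (∀ x y z → x ∈ elems K → y ∈ elems K → z ∈ elems K →
       x ≢ y → y ≢ z → x ≢ z →
       (Homog3 G x y z ⇔ Homog3 G' x y z))

module OnFrame {V : Set} (G G' : Graph V) (k : ℕ) (k%4≡3 : k % 4 ≡ 3) (agree : Agree G G' k)
  (x y c d e : V) (R′ : List V) (W-unique : Unique (x ∷ y ∷ c ∷ d ∷ e ∷ R′)) (R-size : 3 + length R′ ≡ k)
  where

  W : List V
  W = x ∷ y ∷ c ∷ d ∷ e ∷ R′

  D : Graph V
  D = difference G G'

  E : Bool
  E = odd (edgesOn D W)

  Δ : V → Bool
  Δ v = odd (degIn D v W)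

  even-on-k-sets : (K : Subset V k) → odd (edgesOn D (elems K)) ≡ false
  even-on-k-sets K = trans (edges-difference G G' (elems K)) (≡⇒xor≡false same-parity)
    where
    same-parity : odd (edgesOn G (elems K)) ≡ odd (edgesOn G' (elems K))
    same-parity = trans (sym (odd-%2 (edgesOn G (elems K))))
                        (trans (cong odd (proj₁ (agree K))) (odd-%2 (edgesOn G' (elems K))))

  without : ∀ {i j} (p : i ∈ W) → j ∈ (W ─ p) → Subset V k
  without p q = record
    { elems  = W ─ p ─ q
    ; unique = ─-unique q (─-unique p W-unique)
    ; size   = suc-injective (suc-injective (begin
        suc (suc (length (W ─ p ─ q))) ≡⟨ cong suc (─-length q) ⟨
        suc (length (W ─ p))           ≡⟨ ─-length p ⟨
        length W                       ≡⟨ cong (2 +_) R-size ⟩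
        2 + k                          ∎))
    }

  affine : ∀ {i j} → i ∈ W → j ∈ W → i ≢ j → adj D i j ≡ (E xor Δ i) xor Δ j
  affine {i} {j} i∈W j∈W i≢j = begin
    adj D i j                                       ≡⟨ pair-deletion D W i∈W j∈W─i ⟩
    ((E xor Δ i) xor Δ j) xor odd (edgesOn D (W ─ i∈W ─ j∈W─i))
                                                    ≡⟨ cong (((E xor Δ i) xor Δ j) xor_) (even-on-k-sets (without i∈W j∈W─i)) ⟩
    ((E xor Δ i) xor Δ j) xor false                 ≡⟨ xor-identityʳ _ ⟩
    (E xor Δ i) xor Δ j                             ∎
    where
    j∈W─i = ─-∈ j∈W i∈W (i≢j ∘ sym)

  -- |W| ≡ 1 (mod 4) forces the constant term E to vanish
  E≡false : E ≡ false
  E≡false = begin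
    E                                                                      ≡⟨ affine-edges D E Δ W W-unique affine ⟩
    (odd (choose2 (length W)) ∧ E) xor (not (odd (length W)) ∧ ⨁ Δ W)      ≡⟨ cong₂ (λ t n → (t ∧ E) xor (not n ∧ ⨁ Δ W))
                                                                                   choose2-even W-odd ⟩
    false                                                                  ∎
    where
    W-odd : odd (length W) ≡ true
    W-odd = trans (cong (odd ∘ (2 +_)) R-size) (proj₁ (mod4-parities k k%4≡3))
    choose2-even : odd (choose2 (length W)) ≡ false
    choose2-even = trans (cong (odd ∘ choose2 ∘ (2 +_)) R-size) (proj₂ (mod4-parities k k%4≡3))

  cut : ∀ {i j} → i ∈ W → j ∈ W → i ≢ j → adj D i j ≡ Δ i xor Δ j
  cut {i} {j} i∈W j∈W i≢j = trans (affine i∈W j∈W i≢j) (cong (λ t → (t xor Δ i) xor Δ j) E≡false)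

  heads : List V
  heads = x ∷ y ∷ c ∷ d ∷ e ∷ []

  pt : Fin 5 → V
  pt = lookup heads

  pt∈W : ∀ i → pt i ∈ W
  pt∈W i = ∈-++⁺ˡ {ys = R′} (∈-lookup {xs = heads} i)

  heads-facts : Unique heads × Unique R′ × (∀ {v} → v ∈ heads → v ∉ R′)
  heads-facts = ++-unique⁻ heads W-unique

  pt-injective : ∀ {i j} → pt i ≡ pt j → i ≡ j
  pt-injective = lookup-injective (proj₁ heads-facts)

  through : ∀ {a b c} → Unique (a ∷ b ∷ c ∷ []) → Subset V k
  through {a} {b} {c} abc = record
    { elems  = pt a ∷ pt b ∷ pt c ∷ R′
    ; unique = ++⁺ (map⁺ pt-injective abc) (proj₁ (proj₂ heads-facts)) disjoint
    ; size   = R-size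
    }
    where
    disjoint : ∀ {v} → ¬ (v ∈ pt a ∷ pt b ∷ pt c ∷ [] × v ∈ R′)
    disjoint (here refl , v∈R′)                 = proj₂ (proj₂ heads-facts) (∈-lookup a) v∈R′
    disjoint (there (here refl) , v∈R′)         = proj₂ (proj₂ heads-facts) (∈-lookup b) v∈R′
    disjoint (there (there (here refl)) , v∈R′) = proj₂ (proj₂ heads-facts) (∈-lookup c) v∈R′

  -- Two named points of one Δ-class are separated by G, seen from a named
  -- point of the other class: flipping the two D-edges at c would otherwise
  -- change the homogeneity of the triangle abc.
  separated : ∀ {a b c} → Unique (a ∷ b ∷ c ∷ []) →
              Δ (pt a) ≡ Δ (pt b) → Δ (pt c) ≢ Δ (pt a) → adj G (pt a) (pt c) ≢ adj G (pt b) (pt c)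
  separated {a} {b} {c} abc@((a≢b ∷ a≢c ∷ _) ∷ (b≢c ∷ _) ∷ _) Δa≡Δb Δc≢Δa Gac≡Gbc =
    two-flips-change-homogeneity
      (xor≡false⇒≡ _ _ (trans (cut (pt∈W a) (pt∈W b) pa≢pb) (≡⇒xor≡false Δa≡Δb)))
      (xor≡true⇒≡not _ _ (trans (cut (pt∈W b) (pt∈W c) pb≢pc) (≢⇒xor≡true Δb≢Δc)))
      (xor≡true⇒≡not _ _ (trans (cut (pt∈W a) (pt∈W c) pa≢pc) (≢⇒xor≡true (Δc≢Δa ∘ sym))))
      Gac≡Gbc
      (proj₂ (agree (through abc)) (pt a) (pt b) (pt c)
        (here refl) (there (here refl)) (there (there (here refl))) pa≢pb pb≢pc pa≢pc)
    where
    pa≢pb = a≢b ∘ pt-injective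
    pb≢pc = b≢c ∘ pt-injective
    pa≢pc = a≢c ∘ pt-injective
    Δb≢Δc : Δ (pt b) ≢ Δ (pt c)
    Δb≢Δc Δb≡Δc = Δc≢Δa (sym (trans Δa≡Δb Δb≡Δc))

  -- x and y lie in the same Δ-class, so D does not join them
  x-and-y-agree : adj G x y ≡ adj G' x y
  x-and-y-agree = xor≡false⇒≡ _ _ (trans (cut (pt∈W (# 0)) (pt∈W (# 1)) (0≢1 ∘ pt-injective))
                                         (≡⇒xor≡false same-class))
    where
    0≢1 : # 0 ≢ # 1
    0≢1 ()
    same-class : Δ x ≡ Δ y
    same-class = FivePoints.same-colour (Δ ∘ pt) (λ i j → adj G (pt i) (pt j)) separated

record Avoiding {V : Set} (x : V) (n : ℕ) (L : List V) : Set where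
  field
    list    : List V
    unique  : Unique list
    avoids  : x ∉ list
    size    : length list ≡ n
    ⊆L      : ∀ {v} → v ∈ list → v ∈ L

-- Dropping x from L, or an arbitrary entry if x does not occur, is possible
-- only up to double negation: membership in L is not decidable.
avoid : ∀ {V : Set} (x : V) {n} L → Unique L → length L ≡ suc n → ¬ ¬ Avoiding x n L
avoid x L uniq len = ¬¬-map choose ¬¬-excluded-middle
  where
  choose : Dec (x ∈ L) → Avoiding x _ L
  choose (yes x∈L) = record
    { list = L ─ x∈L ; unique = ─-unique x∈L uniq ; avoids = ─-∉ uniq x∈L
    ; size = suc-injective (trans (sym (─-length x∈L)) len) ; ⊆L = ─-⊆ x∈L }
  choose (no x∉L) = drop-first L uniq len x∉L
    where
    drop-first : ∀ L′ → Unique L′ → length L′ ≡ suc _ → x ∉ L′ → Avoiding x _ L′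
    drop-first (z ∷ zs) (_ ∷ zs-unique) len′ x∉L′ = record
      { list = zs ; unique = zs-unique ; avoids = x∉L′ ∘ there ; size = suc-injective len′ ; ⊆L = there }

extend-pair : ∀ {V : Set} {x y : V} {k} L → x ≢ y → Unique L → length L ≡ 2 + k →
              ¬ ¬ Σ (List V) (λ R → Unique (x ∷ y ∷ R) × length R ≡ k)
extend-pair {x = x} {y} L x≢y uniq len done =
  avoid x L uniq len λ A →
  avoid y (Avoiding.list A) (Avoiding.unique A) (Avoiding.size A) λ B →
  done (Avoiding.list B ,
        (x≢y ∷ ¬Any⇒All¬ _ (Avoiding.avoids A ∘ Avoiding.⊆L B)) ∷ ¬Any⇒All¬ _ (Avoiding.avoids B) ∷ Avoiding.unique B ,
        Avoiding.size B)

agree⇒equal : ∀ {V : Set} (G G' : Graph V) k → 3 ≤ k → k % 4 ≡ 3 → Subset V (k + 2) →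
              Agree G G' k → ∀ x y → adj G x y ≡ adj G' x y
agree⇒equal G G' k 3≤k k%4≡3 L agree x y =
  decidable-stable (adj G x y ≟ᵇ adj G' x y) λ differ →
  ¬¬-excluded-middle {A = x ≡ y} λ where
    (yes refl) → differ (trans (irrfl G x) (sym (irrfl G' x)))
    (no x≢y)   → extend-pair (elems L) x≢y (unique L) (trans (size L) (+-comm k 2))
                   λ (R , xyR-unique , R-size) → differ (on-frame R xyR-unique R-size 3≤k)
  where
  on-frame : ∀ R → Unique (x ∷ y ∷ R) → length R ≡ k → 3 ≤ k → adj G x y ≡ adj G' x y
  on-frame (c ∷ d ∷ e ∷ R′) uniq R-size _ = OnFrame.x-and-y-agree G G' k k%4≡3 agree x y c d e R′ uniq R-size
  on-frame []              _ refl ()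
  on-frame (_ ∷ [])        _ refl (s≤s ())
  on-frame (_ ∷ _ ∷ [])    _ refl (s≤s (s≤s ()))

equal⇒agree : ∀ {V : Set} (G G' : Graph V) k → (∀ x y → adj G x y ≡ adj G' x y) → Agree G G' k
equal⇒agree G G' k same K = cong (_% 2) (edges-equal (elems K)) , λ u v w _ _ _ _ _ _ → homog-equal u v w
  where
  deg-equal : ∀ v L → degIn G v L ≡ degIn G' v L
  deg-equal v []      = refl
  deg-equal v (u ∷ L) with adj G v u | adj G' v u | same v u
  ... | true  | .true  | refl = cong suc (deg-equal v L)
  ... | false | .false | refl = deg-equal v L
  edges-equal : ∀ L → edgesOn G L ≡ edgesOn G' L
  edges-equal []      = refl
  edges-equal (v ∷ L) = cong₂ _+_ (deg-equal v L) (edges-equal L)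
  homog-equal : ∀ u v w → Homog3 G u v w ⇔ Homog3 G' u v w
  homog-equal u v w = mk⇔
    (λ (uv≡vw , vw≡uw) → trans (sym (same u v)) (trans uv≡vw (same v w)) , trans (sym (same v w)) (trans vw≡uw (same u w)))
    (λ (uv≡vw , vw≡uw) → trans (same u v) (trans uv≡vw (sym (same v w))) , trans (same v w) (trans vw≡uw (sym (same u w))))

theorem4p4 : {V : Set} (G G' : Graph V) (k : ℕ) →
    3 ≤ k → k % 4 ≡ 3 → Subset V (k + 2) →
    ((∀ (K : Subset V k) →
        (edgesOn G (elems K) % 2 ≡ edgesOn G' (elems K) % 2)
        × (∀ x y z → x ∈ elems K → y ∈ elems K → z ∈ elems K →
             x ≢ y → y ≢ z → x ≢ z →
             (Homog3 G x y z ⇔ Homog3 G' x y z)))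
     ⇔ (∀ x y → adj G x y ≡ adj G' x y))
theorem4p4 G G' k 3≤k k%4≡3 L = mk⇔ (agree⇒equal G G' k 3≤k k%4≡3 L) (equal⇒agree G G' k)
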